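{- In the non-deterministic bang calculus, let $\gamma\in\{!\beta,\oplus\}$. For all bang terms $T,P,S$: if $T\to_{\neg\ell\ell,\gamma}P$ and $P\mapsto_\oplus S$, then $T\mapsto_\oplus\cdot\to_\gamma^{=} S$.
   Context: Bang terms with one binary operator $\oplus$: $T ::= x\mid\lambda x.T\mid TS\mid !T\mid\oplus(T_1,T_2)$; contexts $C ::= [\cdot]\mid\lambda x.C\mid TC\mid CT\mid !C\mid\oplus(C,T)\mid\oplus(T,C)$. Rules: $(\lambda x.T)\,!S\mapsto_{!\beta}T[S/x]$; $\oplus(P,Q)\mapsto_\oplus P$ and $\oplus(P,Q)\mapsto_\oplus Q$; $\to_{!\beta},\to_\oplus$ are their contextual closures and the reduction is $\to_{!\beta}\cup\to_\oplus$. Level: $\mathrm{lev}([\cdot])=0$, unchanged under $\lambda$ and application, $+1$ under $!$ and under $\oplus$. $\mathrm{ll}(T)=\inf\{\mathrm{lev}(C)\mid T=C[R], R\text{ a }!\beta\text{ - or }\oplus\text{ -redex}\}$. A $\gamma$-step $C[R]\to_\gamma C[R']$ is internal ($\to_{\neg\ell\ell,\gamma}$) if $\mathrm{lev}(C)>\mathrm{ll}(C[R])$. $\to^{=}$ is the reflexive closure; $\cdot$ composition. -}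

module Defs where

open import Data.Nat using (ℕ; zero; suc; _<_)
open import Data.Fin using (Fin; zero; suc)
open import Data.Product using (Σ; ∃; _×_; _,_)
open import Data.Sum using (_⊎_)
open import Relation.Binary.PropositionalEquality using (_≡_)

data Term (n : ℕ) : Set where
  var : Fin n → Term n
  lam : Term (suc n) → Term n
  app : Term n → Term n → Term n
  bang : Term n → Term n
  oplus : Term n → Term n → Term n

ext : ∀ {n m} → (Fin n → Fin m) → Fin (suc n) → Fin (suc m)
ext ρ zero = zero
ext ρ (suc i) = suc (ρ i)

rename : ∀ {n m} → (Fin n → Fin m) → Term n → Term m
rename ρ (var i) = var (ρ i)
rename ρ (lam t) = lam (rename (ext ρ) t)
rename ρ (app t s) = app (rename ρ t) (rename ρ s)
rename ρ (bang t) = bang (rename ρ t)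
rename ρ (oplus t s) = oplus (rename ρ t) (rename ρ s)

exts : ∀ {n m} → (Fin n → Term m) → Fin (suc n) → Term (suc m)
exts σ zero = var zero
exts σ (suc i) = rename suc (σ i)

subst : ∀ {n m} → (Fin n → Term m) → Term n → Term m
subst σ (var i) = σ i
subst σ (lam t) = lam (subst (exts σ) t)
subst σ (app t s) = app (subst σ t) (subst σ s)
subst σ (bang t) = bang (subst σ t)
subst σ (oplus t s) = oplus (subst σ t) (subst σ s)

-- T[S/x] where x is the variable bound by the λ (index zero).
single : ∀ {n} → Term n → Fin (suc n) → Term n
single s zero = s
single s (suc i) = var i

_[_/0] : ∀ {n} → Term (suc n) → Term n → Term n
t [ s /0] = subst (single s) t

-- Contexts C with one hole.  Ctx n m : the hole is under binders so that
-- the plugged term lives in scope m, while the whole term lives in scope n.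
data Ctx (n : ℕ) : ℕ → Set where
  hole : Ctx n n
  lamC : ∀ {m} → Ctx (suc n) m → Ctx n m
  appR : ∀ {m} → Term n → Ctx n m → Ctx n m
  appL : ∀ {m} → Ctx n m → Term n → Ctx n m
  bangC : ∀ {m} → Ctx n m → Ctx n m
  oplusL : ∀ {m} → Ctx n m → Term n → Ctx n m
  oplusR : ∀ {m} → Term n → Ctx n m → Ctx n m

plug : ∀ {n m} → Ctx n m → Term m → Term n
plug hole r = r
plug (lamC c) r = lam (plug c r)
plug (appR t c) r = app t (plug c r)
plug (appL c t) r = app (plug c r) t
plug (bangC c) r = bang (plug c r)
plug (oplusL c t) r = oplus (plug c r) t
plug (oplusR t c) r = oplus t (plug c r)

lev : ∀ {n m} → Ctx n m → ℕ
lev hole = 0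
lev (lamC c) = lev c
lev (appR t c) = lev c
lev (appL c t) = lev c
lev (bangC c) = suc (lev c)
lev (oplusL c t) = suc (lev c)
lev (oplusR t c) = suc (lev c)

data Rule : Set where
  bangβ : Rule
  ⊕r : Rule

data _↦[_]_ {n : ℕ} : Term n → Rule → Term n → Set where
  β! : ∀ t s → app (lam t) (bang s) ↦[ bangβ ] (t [ s /0])
  ⊕₁ : ∀ p q → oplus p q ↦[ ⊕r ] p
  ⊕₂ : ∀ p q → oplus p q ↦[ ⊕r ] q

Redex : ∀ {n} → Term n → Set
Redex r = Σ Rule λ γ → ∃ λ r' → r ↦[ γ ] r'

_⟶[_]_ : ∀ {n} → Term n → Rule → Term n → Set
_⟶[_]_ {n} t γ p =
  Σ ℕ λ m → Σ (Ctx n m) λ c → Σ (Term m) λ r → Σ (Term m) λ r' →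
    (t ≡ plug c r) × (p ≡ plug c r') × (r ↦[ γ ] r')

-- ll(T) < k : the least level ll(T) = inf{lev C | T = C[R], R a redex}
-- is strictly below k.  Since the set is a set of naturals, the infimum
-- is below k iff some element is below k.
llBelow : ∀ {n} → Term n → ℕ → Set
llBelow {n} t k =
  Σ ℕ λ m → Σ (Ctx n m) λ c → Σ (Term m) λ r →
    (t ≡ plug c r) × Redex r × (lev c < k)

_⟶¬ll[_]_ : ∀ {n} → Term n → Rule → Term n → Set
_⟶¬ll[_]_ {n} t γ p =
  Σ ℕ λ m → Σ (Ctx n m) λ c → Σ (Term m) λ r → Σ (Term m) λ r' →
    (t ≡ plug c r) × (p ≡ plug c r') × (r ↦[ γ ] r') × llBelow t (lev c)

_⟶[_]⁼_ : ∀ {n} → Term n → Rule → Term n → Set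
t ⟶[ γ ]⁼ p = (t ≡ p) ⊎ (t ⟶[ γ ] p)

module Submission where

open import Defs
open import Data.Nat using (ℕ; _<_; z≤n)
open import Data.Nat.Properties using (≤-<-trans)
open import Data.Product using (∃; _×_; _,_)
open import Data.Sum using (inj₁; inj₂)
open import Relation.Binary.PropositionalEquality using (refl)

-- An internal step is never at the root: its level exceeds ll, hence is positive.
llBelow⇒0< : ∀ {n k} {t : Term n} → llBelow t k → 0 < k
llBelow⇒0< (_ , _ , _ , _ , _ , lev<k) = ≤-<-trans z≤n lev<k

plug-⟶ : ∀ {n m γ} (c : Ctx n m) {r r' : Term m} →
  r ↦[ γ ] r' → plug c r ⟶[ γ ] plug c r'
plug-⟶ {m = m} c {r} {r'} step = m , c , r , r' , refl , refl , step

-- Below the root, the ⊕-redex of plug c r' already occurs in plug c r; either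
-- it keeps the branch containing the hole, or it discards the γ-step.
⊕-postpones-nonRoot : ∀ {n m γ} (c : Ctx n m) {r r' : Term m} {s : Term n} →
  0 < lev c → r ↦[ γ ] r' → plug c r' ↦[ ⊕r ] s →
  ∃ λ u → (plug c r ↦[ ⊕r ] u) × (u ⟶[ γ ]⁼ s)
⊕-postpones-nonRoot hole () _ _
⊕-postpones-nonRoot (oplusL c q) _ step (⊕₁ _ _) = _ , ⊕₁ _ _ , inj₂ (plug-⟶ c step)
⊕-postpones-nonRoot (oplusL c q) _ step (⊕₂ _ _) = q , ⊕₂ _ _ , inj₁ refl
⊕-postpones-nonRoot (oplusR p c) _ step (⊕₁ _ _) = p , ⊕₁ _ _ , inj₁ refl
⊕-postpones-nonRoot (oplusR p c) _ step (⊕₂ _ _) = _ , ⊕₂ _ _ , inj₂ (plug-⟶ c step)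
⊕-postpones-nonRoot (lamC _) _ _ ()
⊕-postpones-nonRoot (appR _ _) _ _ ()
⊕-postpones-nonRoot (appL _ _) _ _ ()
⊕-postpones-nonRoot (bangC _) _ _ ()

lemma7 : (γ : Rule) {n : ℕ} (T P S : Term n) →
    T ⟶¬ll[ γ ] P → P ↦[ ⊕r ] S →
    ∃ λ U → (T ↦[ ⊕r ] U) × (U ⟶[ γ ]⁼ S)
lemma7 γ _ _ _ (_ , c , _ , _ , refl , refl , step , ll<lev) =
  ⊕-postpones-nonRoot c (llBelow⇒0< ll<lev) step
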